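{- For every positive integer $n$, as polynomials in $t$, $$\sum_{\substack{\mathbf p=(p_1,\dots,p_l)\\ p_1+\dots+p_l=n}}\frac{(n-1)!}{s_{\mathbf p}}\,\frac{(n-1)!}{s_{\mathbf p'}}\Big(\prod_{i=1}^l p_i\Big)t^l=\prod_{j=1}^n\big(t+j(j-1)\big),$$ where the sum is over all compositions of $n$, $s_{\mathbf p}=\prod_{j=1}^{l-1}(p_1+\dots+p_j)$, and $\mathbf p'=(p_l,\dots,p_1)$ is the reversed composition.
   Context: A composition of $n$ is an ordered list of positive integers summing to $n$ (of any length $l\ge1$). Empty products equal $1$. -}

module Defs where

open import Data.Nat as ℕ using (ℕ; zero; suc; _∸_; _!)
open import Data.List using (List; []; _∷_; [_]; map; concatMap; upTo; length; reverse; foldr)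
open import Data.Nat.ListAction using (product)
open import Data.Rational as ℚ using (ℚ; 0ℚ; 1ℚ; _+_; _*_; _/_)
open import Data.Integer using (+_)

-- Compositions: ordered lists of positive integers summing to n.
-- compositionsFuel f n enumerates them (fuel f ≥ n suffices since parts are ≥ 1);
-- the first part is suc k for k = 0..n-1.
compositionsFuel : ℕ → ℕ → List (List ℕ)
compositionsFuel f zero = [ [] ]
compositionsFuel zero (suc n) = []
compositionsFuel (suc f) (suc n) =
  concatMap (λ k → map (suc k ∷_) (compositionsFuel f (n ∸ k))) (upTo (suc n))

compositions : ℕ → List (List ℕ)
compositions n = compositionsFuel n n

properPartialSums : List ℕ → List ℕ
properPartialSums [] = []
properPartialSums (p ∷ []) = []
properPartialSums (p ∷ q ∷ ps) = p ∷ map (p ℕ.+_) (properPartialSums (q ∷ ps))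

s : List ℕ → ℕ
s p = product (properPartialSums p)

-- rational a / b ; b is always ≥ 1 in use (s_p is a product of positive numbers);
-- the b = 0 branch is an unused convention.
frac : ℕ → ℕ → ℚ
frac a zero = 0ℚ
frac a (suc b) = (+ a) / suc b

-- Polynomials in t with rational coefficients as coefficient lists (constant term first).
Poly : Set
Poly = List ℚ

coeff : Poly → ℕ → ℚ
coeff [] k = 0ℚ
coeff (c ∷ cs) zero = c
coeff (c ∷ cs) (suc k) = coeff cs k

addP : Poly → Poly → Poly
addP [] q = q
addP p [] = p
addP (a ∷ p) (b ∷ q) = (a + b) ∷ addP p q

scaleP : ℚ → Poly → Poly
scaleP c = map (c *_)

mulP : Poly → Poly → Poly
mulP [] q = []
mulP (a ∷ p) q = addP (scaleP a q) (0ℚ ∷ mulP p q)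

monomial : ℚ → ℕ → Poly
monomial c zero = [ c ]
monomial c (suc l) = 0ℚ ∷ monomial c l

sumP : List Poly → Poly
sumP = foldr addP []

prodP : List Poly → Poly
prodP = foldr mulP [ 1ℚ ]

ℕtoℚ : ℕ → ℚ
ℕtoℚ m = (+ m) / 1

lhs : ℕ → Poly
lhs n = sumP (map (λ p → monomial
          (frac ((n ∸ 1) !) (s p) * frac ((n ∸ 1) !) (s (reverse p)) * ℕtoℚ (product p))
          (length p)) (compositions n))

rhs : ℕ → Poly
rhs n = prodP (map (λ j → ℕtoℚ (j ℕ.* (j ∸ 1)) ∷ 1ℚ ∷ []) (map suc (upTo n)))

module Submission where

-- With w σ = 1/(σ(n−σ)), the reversed composition p′ has s_{p′} = ∏ (n − σ) over the proper
-- partial sums σ of p, so the left side is ((n−1)!)² Σ_p (∏ p_i) (∏_σ w σ) t^l. Splitting off the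
-- first part, the generating polynomials V r of compositions of r (partial sums shifted by n − r)
-- satisfy V 0 = 0, V 1 = t and V (r+2) − 2 V (r+1) + V r = w (r+1) · t · V (r+1). In the basis
-- B i = t ∏_{j≤i} (t + j(j−1)), on which t acts by t B i = B (i+1) − (i+1)i B i, this recursion is
-- solved by V r = Σ_i β_i C(r, i+1) B i with β_i = ∏_{m≤i} w m, thanks to the identity
-- (j+1)(n−j−1) C(r+1,j+1) = (j+2)(j+1) C(r+1,j+2) + (r+1)(n−r−1) C(r,j). At r = n the coordinates
-- ((n−1)!)² β_i C(n, i+1) = n!(n−1)!/((i+1)! i!) = ∏_{j=i+2}^{n} j(j−1) are exactly those of
-- ∏_{j≤n} (t + j(j−1)).

open import Defs
open import Level using (0ℓ)
open import Data.Nat as ℕ using (ℕ; zero; suc; _+_; _*_; _∸_; _<_; _≤_; z≤n; s≤s; _!; NonZero)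
import Data.Nat.Properties as ℕP
open import Data.Nat.Combinatorics
  using (_C_; nC1≡n; nCk+nC[k+1]≡[n+1]C[k+1]; k>n⇒nCk≡0; nCk≡n!/k![n-k]!; k![n∸k]!∣n!; [n-k]*[n-k-1]!≡[n-k]!)
open import Data.Nat.DivMod using (m/n*n≡m)
open import Data.Nat.ListAction using (sum; product)
open import Data.Nat.ListAction.Properties using (sum-↭; product-↭)
import Data.Nat.Tactic.RingSolver as ℕ-Solver
import Data.Integer as ℤ
import Data.Integer.Properties as ℤP
open import Data.Rational as ℚ using (ℚ; 0ℚ; 1ℚ; -_)
import Data.Rational.Properties as ℚP
open import Data.Rational.Unnormalised as ℚᵘ using (mkℚᵘ; *≡*)
import Data.Rational.Unnormalised.Properties as ℚᵘP
open import Data.List using (List; []; _∷_; [_]; _++_; _∷ʳ_; map; concatMap; applyUpTo; upTo; foldr; length; reverse)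
import Data.List.Properties as List
open import Data.List.Relation.Unary.All as All using (All; []; _∷_)
import Data.List.Relation.Unary.All.Properties as All
open import Data.List.Relation.Binary.Permutation.Propositional.Properties using (↭-reverse)
open import Data.Product using (_×_; _,_; proj₂)
open import Function using (_∘_; id)
open import Relation.Nullary using (Dec; yes; no)
open import Relation.Nullary.Decidable using (dec⇒maybe)
open import Relation.Binary.Bundles using (Setoid)
open import Relation.Binary.PropositionalEquality hiding ([_])
import Relation.Binary.Reasoning.Setoid as SetoidReasoning
open import Tactic.RingSolver using (solve-∀)
open import Tactic.RingSolver.Core.AlmostCommutativeRing using (AlmostCommutativeRing; fromCommutativeRing)

-- Rational arithmetic

ℚ-ring : AlmostCommutativeRing 0ℓ 0ℓ
ℚ-ring = fromCommutativeRing ℚP.+-*-commutativeRing (λ x → dec⇒maybe (0ℚ ℚ.≟ x))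

fromℚᵘ-homo-+ : ∀ p q → ℚ.fromℚᵘ (p ℚᵘ.+ q) ≡ ℚ.fromℚᵘ p ℚ.+ ℚ.fromℚᵘ q
fromℚᵘ-homo-+ p q = ℚP.toℚᵘ-injective (begin
  ℚ.toℚᵘ (ℚ.fromℚᵘ (p ℚᵘ.+ q))                      ≈⟨ ℚP.toℚᵘ-fromℚᵘ _ ⟩
  p ℚᵘ.+ q                                          ≈⟨ ℚᵘP.+-cong (ℚP.toℚᵘ-fromℚᵘ p) (ℚP.toℚᵘ-fromℚᵘ q) ⟨
  ℚ.toℚᵘ (ℚ.fromℚᵘ p) ℚᵘ.+ ℚ.toℚᵘ (ℚ.fromℚᵘ q)       ≈⟨ ℚP.toℚᵘ-homo-+ (ℚ.fromℚᵘ p) (ℚ.fromℚᵘ q) ⟨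
  ℚ.toℚᵘ (ℚ.fromℚᵘ p ℚ.+ ℚ.fromℚᵘ q)                ∎)
  where open SetoidReasoning ℚᵘP.≃-setoid

fromℚᵘ-homo-* : ∀ p q → ℚ.fromℚᵘ (p ℚᵘ.* q) ≡ ℚ.fromℚᵘ p ℚ.* ℚ.fromℚᵘ q
fromℚᵘ-homo-* p q = ℚP.toℚᵘ-injective (begin
  ℚ.toℚᵘ (ℚ.fromℚᵘ (p ℚᵘ.* q))                      ≈⟨ ℚP.toℚᵘ-fromℚᵘ _ ⟩
  p ℚᵘ.* q                                          ≈⟨ ℚᵘP.*-cong (ℚP.toℚᵘ-fromℚᵘ p) (ℚP.toℚᵘ-fromℚᵘ q) ⟨
  ℚ.toℚᵘ (ℚ.fromℚᵘ p) ℚᵘ.* ℚ.toℚᵘ (ℚ.fromℚᵘ q)       ≈⟨ ℚP.toℚᵘ-homo-* (ℚ.fromℚᵘ p) (ℚ.fromℚᵘ q) ⟨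
  ℚ.toℚᵘ (ℚ.fromℚᵘ p ℚ.* ℚ.fromℚᵘ q)                ∎)
  where open SetoidReasoning ℚᵘP.≃-setoid

ℕtoℚ-homo-+ : ∀ a b → ℕtoℚ (a + b) ≡ ℕtoℚ a ℚ.+ ℕtoℚ b
ℕtoℚ-homo-+ a b = trans (ℚP.fromℚᵘ-cong {mkℚᵘ (ℤ.+ (a + b)) 0} {mkℚᵘ (ℤ.+ a) 0 ℚᵘ.+ mkℚᵘ (ℤ.+ b) 0}
                                         (*≡* (cong (ℤ._* ℤ.+ 1) eq)))
                        (fromℚᵘ-homo-+ (mkℚᵘ (ℤ.+ a) 0) (mkℚᵘ (ℤ.+ b) 0))
  where
  eq : ℤ.+ (a + b) ≡ ℤ.+ a ℤ.* ℤ.+ 1 ℤ.+ ℤ.+ b ℤ.* ℤ.+ 1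
  eq = trans (ℤP.pos-+ a b) (sym (cong₂ ℤ._+_ (ℤP.*-identityʳ (ℤ.+ a)) (ℤP.*-identityʳ (ℤ.+ b))))

ℕtoℚ-homo-* : ∀ a b → ℕtoℚ (a * b) ≡ ℕtoℚ a ℚ.* ℕtoℚ b
ℕtoℚ-homo-* a b = trans (cong (λ z → ℚ.fromℚᵘ (mkℚᵘ z 0)) (ℤP.pos-* a b))
                        (fromℚᵘ-homo-* (mkℚᵘ (ℤ.+ a) 0) (mkℚᵘ (ℤ.+ b) 0))

frac≡ℕtoℚ*frac1 : ∀ a b → frac a b ≡ ℕtoℚ a ℚ.* frac 1 b
frac≡ℕtoℚ*frac1 a zero = sym (ℚP.*-zeroʳ (ℕtoℚ a))
frac≡ℕtoℚ*frac1 a (suc b) = trans (ℚP.fromℚᵘ-cong {mkℚᵘ (ℤ.+ a) b} {mkℚᵘ (ℤ.+ a) 0 ℚᵘ.* mkℚᵘ (ℤ.+ 1) b} (*≡* eq))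
                                  (fromℚᵘ-homo-* (mkℚᵘ (ℤ.+ a) 0) (mkℚᵘ (ℤ.+ 1) b))
  where
  eq : ℤ.+ a ℤ.* ℤ.+ (1 * suc b) ≡ (ℤ.+ a ℤ.* ℤ.+ 1) ℤ.* ℤ.+ suc b
  eq = cong₂ (λ x y → x ℤ.* ℤ.+ y) (sym (ℤP.*-identityʳ (ℤ.+ a))) (ℕP.*-identityˡ (suc b))

frac1-homo-* : ∀ a b → frac 1 (a * b) ≡ frac 1 a ℚ.* frac 1 b
frac1-homo-* zero b = sym (ℚP.*-zeroˡ (frac 1 b))
frac1-homo-* (suc a) zero = trans (cong (frac 1) (ℕP.*-zeroʳ a)) (sym (ℚP.*-zeroʳ (frac 1 (suc a))))
frac1-homo-* (suc a) (suc b) = fromℚᵘ-homo-* (mkℚᵘ (ℤ.+ 1) a) (mkℚᵘ (ℤ.+ 1) b)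

frac1*ℕtoℚ≡1 : ∀ b .{{_ : NonZero b}} → frac 1 b ℚ.* ℕtoℚ b ≡ 1ℚ
frac1*ℕtoℚ≡1 (suc b) = trans (sym (fromℚᵘ-homo-* (mkℚᵘ (ℤ.+ 1) b) (mkℚᵘ (ℤ.+ suc b) 0)))
                             (ℚP.fromℚᵘ-cong {mkℚᵘ (ℤ.+ 1) b ℚᵘ.* mkℚᵘ (ℤ.+ suc b) 0} {mkℚᵘ (ℤ.+ 1) 0} (*≡* eq))
  where
  eq : (ℤ.+ 1 ℤ.* ℤ.+ suc b) ℤ.* ℤ.+ 1 ≡ ℤ.+ 1 ℤ.* ℤ.+ (suc b * 1)
  eq = trans (ℤP.*-identityʳ _) (cong (λ z → ℤ.+ 1 ℤ.* ℤ.+ z) (sym (ℕP.*-identityʳ (suc b))))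

frac*ℕtoℚ≡ℕtoℚ : ∀ a b .{{_ : NonZero b}} → frac a b ℚ.* ℕtoℚ b ≡ ℕtoℚ a
frac*ℕtoℚ≡ℕtoℚ a b = begin
  frac a b ℚ.* ℕtoℚ b                   ≡⟨ cong (ℚ._* ℕtoℚ b) (frac≡ℕtoℚ*frac1 a b) ⟩
  ℕtoℚ a ℚ.* frac 1 b ℚ.* ℕtoℚ b        ≡⟨ ℚP.*-assoc (ℕtoℚ a) (frac 1 b) (ℕtoℚ b) ⟩
  ℕtoℚ a ℚ.* (frac 1 b ℚ.* ℕtoℚ b)      ≡⟨ cong (ℕtoℚ a ℚ.*_) (frac1*ℕtoℚ≡1 b) ⟩
  ℕtoℚ a ℚ.* 1ℚ                         ≡⟨ ℚP.*-identityʳ (ℕtoℚ a) ⟩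
  ℕtoℚ a                                ∎
  where open ≡-Reasoning

*ℕtoℚ-cancelʳ : ∀ b .{{_ : NonZero b}} {x y} → x ℚ.* ℕtoℚ b ≡ y ℚ.* ℕtoℚ b → x ≡ y
*ℕtoℚ-cancelʳ b {x} {y} eq = begin
  x                                     ≡⟨ unscale x ⟨
  x ℚ.* ℕtoℚ b ℚ.* frac 1 b             ≡⟨ cong (ℚ._* frac 1 b) eq ⟩
  y ℚ.* ℕtoℚ b ℚ.* frac 1 b             ≡⟨ unscale y ⟩
  y                                     ∎
  where
  open ≡-Reasoning
  unscale : ∀ z → z ℚ.* ℕtoℚ b ℚ.* frac 1 b ≡ z
  unscale z = trans (ℚP.*-assoc z (ℕtoℚ b) (frac 1 b))
             (trans (cong (z ℚ.*_) (trans (ℚP.*-comm (ℕtoℚ b) (frac 1 b)) (frac1*ℕtoℚ≡1 b))) (ℚP.*-identityʳ z))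

frac-*ˡ : ∀ a b c → frac (a * b) c ≡ ℕtoℚ a ℚ.* frac b c
frac-*ˡ a b c = begin
  frac (a * b) c                       ≡⟨ frac≡ℕtoℚ*frac1 (a * b) c ⟩
  ℕtoℚ (a * b) ℚ.* frac 1 c            ≡⟨ cong (ℚ._* frac 1 c) (ℕtoℚ-homo-* a b) ⟩
  ℕtoℚ a ℚ.* ℕtoℚ b ℚ.* frac 1 c       ≡⟨ ℚP.*-assoc (ℕtoℚ a) (ℕtoℚ b) (frac 1 c) ⟩
  ℕtoℚ a ℚ.* (ℕtoℚ b ℚ.* frac 1 c)     ≡⟨ cong (ℕtoℚ a ℚ.*_) (frac≡ℕtoℚ*frac1 b c) ⟨
  ℕtoℚ a ℚ.* frac b c                  ∎
  where open ≡-Reasoning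

productℚ : List ℚ → ℚ
productℚ = foldr ℚ._*_ 1ℚ

productℚ-map-* : ∀ {A : Set} (f g : A → ℚ) xs →
  productℚ (map f xs) ℚ.* productℚ (map g xs) ≡ productℚ (map (λ x → f x ℚ.* g x) xs)
productℚ-map-* f g [] = refl
productℚ-map-* f g (x ∷ xs) = trans (interchange (f x) (productℚ (map f xs)) (g x) (productℚ (map g xs)))
                                     (cong (f x ℚ.* g x ℚ.*_) (productℚ-map-* f g xs))
  where
  interchange : ∀ a b c d → (a ℚ.* b) ℚ.* (c ℚ.* d) ≡ (a ℚ.* c) ℚ.* (b ℚ.* d)
  interchange = solve-∀ ℚ-ring

frac1-homo-product : ∀ l → frac 1 (product l) ≡ productℚ (map (frac 1) l)
frac1-homo-product [] = refl
frac1-homo-product (x ∷ l) = trans (frac1-homo-* x (product l)) (cong (frac 1 x ℚ.*_) (frac1-homo-product l))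

-- Binomial coefficients

[1+n]*nCk≡[1+k]*[1+n]C[1+k] : ∀ n k → suc n * (n C k) ≡ suc k * (suc n C suc k)
[1+n]*nCk≡[1+k]*[1+n]C[1+k] zero zero = refl
[1+n]*nCk≡[1+k]*[1+n]C[1+k] zero (suc k) =
  sym (trans (cong (suc (suc k) *_) (k>n⇒nCk≡0 {1} {suc (suc k)} (s≤s (s≤s z≤n)))) (ℕP.*-zeroʳ (suc (suc k))))
[1+n]*nCk≡[1+k]*[1+n]C[1+k] (suc n) zero =
  trans (ℕP.*-identityʳ (suc (suc n))) (sym (trans (ℕP.*-identityˡ _) (nC1≡n (suc (suc n)))))
[1+n]*nCk≡[1+k]*[1+n]C[1+k] (suc n) (suc k) = begin
  suc (suc n) * (suc n C suc k)
    ≡⟨ cong (suc (suc n) *_) (nCk+nC[k+1]≡[n+1]C[k+1] n k) ⟨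
  suc (suc n) * (n C k + n C suc k)
    ≡⟨ regroup (suc n) (n C k) (n C suc k) ⟩
  (n C k + n C suc k) + (suc n * (n C k) + suc n * (n C suc k))
    ≡⟨ cong₂ (λ a b → (n C k + n C suc k) + (a + b)) ([1+n]*nCk≡[1+k]*[1+n]C[1+k] n k) ([1+n]*nCk≡[1+k]*[1+n]C[1+k] n (suc k)) ⟩
  (n C k + n C suc k) + (suc k * X + suc (suc k) * Y)
    ≡⟨ cong (_+ (suc k * X + suc (suc k) * Y)) (nCk+nC[k+1]≡[n+1]C[k+1] n k) ⟩
  X + (suc k * X + suc (suc k) * Y)
    ≡⟨ collect (suc k) X Y ⟩
  suc (suc k) * (X + Y)
    ≡⟨ cong (suc (suc k) *_) (nCk+nC[k+1]≡[n+1]C[k+1] (suc n) (suc k)) ⟩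
  suc (suc k) * (suc (suc n) C suc (suc k)) ∎
  where
  open ≡-Reasoning
  X = suc n C suc k
  Y = suc n C suc (suc k)
  regroup : ∀ m a b → suc m * (a + b) ≡ (a + b) + (m * a + m * b)
  regroup = ℕ-Solver.solve-∀
  collect : ∀ m x y → x + (m * x + suc m * y) ≡ suc m * (x + y)
  collect = ℕ-Solver.solve-∀

[1+n]*nC[1+k]≡[n∸k]*[1+n]C[1+k] : ∀ n k → suc n * (n C suc k) ≡ (n ∸ k) * (suc n C suc k)
[1+n]*nC[1+k]≡[n∸k]*[1+n]C[1+k] n k = begin
  suc n * (n C suc k)
    ≡⟨ ℕP.m+n∸n≡m (suc n * (n C suc k)) (suc k * X) ⟨
  suc n * (n C suc k) + suc k * X ∸ suc k * X
    ≡⟨ cong (λ a → suc n * (n C suc k) + a ∸ suc k * X) ([1+n]*nCk≡[1+k]*[1+n]C[1+k] n k) ⟨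
  suc n * (n C suc k) + suc n * (n C k) ∸ suc k * X ≡⟨ cong (_∸ suc k * X) (ℕP.*-distribˡ-+ (suc n) (n C suc k) (n C k)) ⟨
  suc n * (n C suc k + n C k) ∸ suc k * X
    ≡⟨ cong (λ a → suc n * a ∸ suc k * X) (trans (ℕP.+-comm (n C suc k) (n C k)) (nCk+nC[k+1]≡[n+1]C[k+1] n k)) ⟩
  suc n * X ∸ suc k * X
    ≡⟨ ℕP.*-distribʳ-∸ X (suc n) (suc k) ⟨
  (n ∸ k) * X ∎
  where
  open ≡-Reasoning
  X = suc n C suc k

[n∸m]+[o∸n]≡o∸m : ∀ {m n o} → m ≤ n → n ≤ o → (n ∸ m) + (o ∸ n) ≡ o ∸ m
[n∸m]+[o∸n]≡o∸m {m} {n} {o} m≤n n≤o = begin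
  (n ∸ m) + (o ∸ n)   ≡⟨ ℕP.+-comm (n ∸ m) (o ∸ n) ⟩
  (o ∸ n) + (n ∸ m)   ≡⟨ ℕP.+-∸-assoc (o ∸ n) m≤n ⟨
  (o ∸ n) + n ∸ m     ≡⟨ cong (_∸ m) (ℕP.m∸n+n≡m n≤o) ⟩
  o ∸ m               ∎
  where open ≡-Reasoning

-- Both sides equal (j+1)·((r−j) + (n−r−1))·C(r+1,j+1), by the two absorption identities above.
weightedPascal : ∀ n r j → suc r ≤ n →
  suc j * (n ∸ suc j) * (suc r C suc j) ≡ suc (suc j) * suc j * (suc r C suc (suc j)) + suc r * (n ∸ suc r) * (r C j)
weightedPascal n r j r<n = begin
  suc j * (n ∸ suc j) * X
    ≡⟨ sum-of-gaps (j ℕP.≤? r) ⟨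
  suc j * ((r ∸ j) + (n ∸ suc r)) * X
    ≡⟨ distribute (suc j) (r ∸ j) (n ∸ suc r) X ⟩
  suc j * ((r ∸ j) * X) + (n ∸ suc r) * (suc j * X)
    ≡⟨ cong₂ (λ a b → suc j * a + (n ∸ suc r) * b) ([1+n]*nC[1+k]≡[n∸k]*[1+n]C[1+k] r j) ([1+n]*nCk≡[1+k]*[1+n]C[1+k] r j) ⟨
  suc j * (suc r * (r C suc j)) + (n ∸ suc r) * (suc r * (r C j))
    ≡⟨ cong (λ a → suc j * a + (n ∸ suc r) * (suc r * (r C j))) ([1+n]*nCk≡[1+k]*[1+n]C[1+k] r (suc j)) ⟩
  suc j * (suc (suc j) * Z) + (n ∸ suc r) * (suc r * (r C j))
    ≡⟨ rearrange (suc j) (suc (suc j)) Z (n ∸ suc r) (suc r) (r C j) ⟩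
  suc (suc j) * suc j * Z + suc r * (n ∸ suc r) * (r C j) ∎
  where
  open ≡-Reasoning
  X = suc r C suc j
  Z = suc r C suc (suc j)
  sum-of-gaps : Dec (j ≤ r) → suc j * ((r ∸ j) + (n ∸ suc r)) * X ≡ suc j * (n ∸ suc j) * X
  sum-of-gaps (yes j≤r) = cong (λ a → suc j * a * X) ([n∸m]+[o∸n]≡o∸m (s≤s j≤r) r<n)
  sum-of-gaps (no j≰r) = trans (vanishes (suc j * ((r ∸ j) + (n ∸ suc r)))) (sym (vanishes (suc j * (n ∸ suc j))))
    where
    vanishes : ∀ a → a * X ≡ 0
    vanishes a = trans (cong (a *_) (k>n⇒nCk≡0 (s≤s (ℕP.≰⇒> j≰r)))) (ℕP.*-zeroʳ a)
  distribute : ∀ a b c x → a * (b + c) * x ≡ a * (b * x) + c * (a * x)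
  distribute = ℕ-Solver.solve-∀
  rearrange : ∀ a b z c d y → a * (b * z) + c * (d * y) ≡ b * a * z + d * c * y
  rearrange = ℕ-Solver.solve-∀

nCk*[k!*[n∸k]!]≡n! : ∀ {n k} → k ≤ n → (n C k) * (k ! * (n ∸ k) !) ≡ n !
nCk*[k!*[n∸k]!]≡n! {n} {k} k≤n =
  trans (cong (_* (k ! * (n ∸ k) !)) (nCk≡n!/k![n-k]! k≤n)) (m/n*n≡m {{ℕP._!*_!≢0 k (n ∸ k)}} (k![n∸k]!∣n! k≤n))

-- Defs represents polynomials by coefficient lists, which have no canonical form; we compare
-- them through coeff, as sequences up to pointwise equality _≗_.
Coeffs : Set
Coeffs = ℕ → ℚ

module ≗ = Setoid (ℕ →-setoid ℚ)
module ≗-Reasoning = SetoidReasoning (ℕ →-setoid ℚ)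

infixl 6 _⊕_
infixr 7 _⊙_ t·_

0ᶜ : Coeffs
0ᶜ _ = 0ℚ

1ᶜ : Coeffs
1ᶜ zero = 1ℚ
1ᶜ (suc k) = 0ℚ

_⊕_ : Coeffs → Coeffs → Coeffs
(f ⊕ g) k = f k ℚ.+ g k

_⊙_ : ℚ → Coeffs → Coeffs
(c ⊙ f) k = c ℚ.* f k

t·_ : Coeffs → Coeffs
(t· f) zero = 0ℚ
(t· f) (suc k) = f k

⊕-cong : ∀ {f f′ g g′} → f ≗ f′ → g ≗ g′ → f ⊕ g ≗ f′ ⊕ g′
⊕-cong f≗f′ g≗g′ k = cong₂ ℚ._+_ (f≗f′ k) (g≗g′ k)

⊕-congˡ : ∀ f {g g′} → g ≗ g′ → f ⊕ g ≗ f ⊕ g′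
⊕-congˡ f g≗g′ k = cong (f k ℚ.+_) (g≗g′ k)

⊙-cong : ∀ {c c′ f f′} → c ≡ c′ → f ≗ f′ → c ⊙ f ≗ c′ ⊙ f′
⊙-cong c≡c′ f≗f′ k = cong₂ ℚ._*_ c≡c′ (f≗f′ k)

⊙-congʳ : ∀ c {f f′} → f ≗ f′ → c ⊙ f ≗ c ⊙ f′
⊙-congʳ c f≗f′ k = cong (c ℚ.*_) (f≗f′ k)

t·-cong : ∀ {f g} → f ≗ g → t· f ≗ t· g
t·-cong f≗g zero = refl
t·-cong f≗g (suc k) = f≗g k

⊕-comm : ∀ f g → f ⊕ g ≗ g ⊕ f
⊕-comm f g k = ℚP.+-comm (f k) (g k)

⊕-assoc : ∀ f g h → f ⊕ g ⊕ h ≗ f ⊕ (g ⊕ h)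
⊕-assoc f g h k = ℚP.+-assoc (f k) (g k) (h k)

⊕-identityˡ : ∀ f → 0ᶜ ⊕ f ≗ f
⊕-identityˡ f k = ℚP.+-identityˡ (f k)

⊕-identityʳ : ∀ f → f ⊕ 0ᶜ ≗ f
⊕-identityʳ f k = ℚP.+-identityʳ (f k)

⊙-distribʳ-+ : ∀ c d f → (c ℚ.+ d) ⊙ f ≗ c ⊙ f ⊕ d ⊙ f
⊙-distribʳ-+ c d f k = ℚP.*-distribʳ-+ (f k) c d

⊙-assoc : ∀ c d f → (c ℚ.* d) ⊙ f ≗ c ⊙ d ⊙ f
⊙-assoc c d f k = ℚP.*-assoc c d (f k)

⊙-identityˡ : ∀ f → 1ℚ ⊙ f ≗ f
⊙-identityˡ f k = ℚP.*-identityˡ (f k)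

⊙-zeroˡ : ∀ f → 0ℚ ⊙ f ≗ 0ᶜ
⊙-zeroˡ f k = ℚP.*-zeroˡ (f k)

⊙-distribˡ-⊕ : ∀ c f g → c ⊙ (f ⊕ g) ≗ c ⊙ f ⊕ c ⊙ g
⊙-distribˡ-⊕ c f g k = ℚP.*-distribˡ-+ c (f k) (g k)

⊙-zeroʳ : ∀ c → c ⊙ 0ᶜ ≗ 0ᶜ
⊙-zeroʳ c k = ℚP.*-zeroʳ c

t·-homo-⊕ : ∀ f g → t· (f ⊕ g) ≗ t· f ⊕ t· g
t·-homo-⊕ f g zero = sym (ℚP.+-identityʳ 0ℚ)
t·-homo-⊕ f g (suc k) = refl

t·-homo-⊙ : ∀ c f → t· (c ⊙ f) ≗ c ⊙ t· f
t·-homo-⊙ c f zero = sym (ℚP.*-zeroʳ c)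
t·-homo-⊙ c f (suc k) = refl

t·-zero : t· 0ᶜ ≗ 0ᶜ
t·-zero zero = refl
t·-zero (suc k) = refl

infix 6.5 ∑<-syntax ∑∈-syntax

∑<-syntax : ℕ → (ℕ → Coeffs) → Coeffs
∑<-syntax zero g = 0ᶜ
∑<-syntax (suc m) g = g 0 ⊕ ∑<-syntax m (g ∘ suc)

syntax ∑<-syntax m (λ i → g) = ∑[ i < m ] g

∑∈-syntax : {A : Set} → List A → (A → Coeffs) → Coeffs
∑∈-syntax [] g = 0ᶜ
∑∈-syntax (x ∷ xs) g = g x ⊕ ∑∈-syntax xs g

syntax ∑∈-syntax xs (λ x → g) = ∑[ x ∈ xs ] g

record Additive (φ : Coeffs → Coeffs) : Set where
  field
    homo-⊕ : ∀ f g → φ (f ⊕ g) ≗ φ f ⊕ φ g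
    homo-0 : φ 0ᶜ ≗ 0ᶜ

⊙-additive : ∀ c → Additive (c ⊙_)
⊙-additive c = record { homo-⊕ = ⊙-distribˡ-⊕ c ; homo-0 = ⊙-zeroʳ c }

t·-additive : Additive t·_
t·-additive = record { homo-⊕ = t·-homo-⊕ ; homo-0 = t·-zero }

∑<-cong : ∀ m {g h : ℕ → Coeffs} → (∀ i → i < m → g i ≗ h i) → ∑[ i < m ] g i ≗ ∑[ i < m ] h i
∑<-cong zero g≗h k = refl
∑<-cong (suc m) g≗h = ⊕-cong (g≗h 0 (s≤s z≤n)) (∑<-cong m (λ i i<m → g≗h (suc i) (s≤s i<m)))

∑<-zero : ∀ m {g : ℕ → Coeffs} → (∀ i → i < m → g i ≗ 0ᶜ) → ∑[ i < m ] g i ≗ 0ᶜ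
∑<-zero zero g≗0 k = refl
∑<-zero (suc m) g≗0 =
  ≗.trans (⊕-cong (g≗0 0 (s≤s z≤n)) (∑<-zero m (λ i i<m → g≗0 (suc i) (s≤s i<m)))) (⊕-identityˡ 0ᶜ)

∑<-⊕ : ∀ m (g h : ℕ → Coeffs) → ∑[ i < m ] (g i ⊕ h i) ≗ ∑[ i < m ] g i ⊕ ∑[ i < m ] h i
∑<-⊕ zero g h k = sym (ℚP.+-identityʳ 0ℚ)
∑<-⊕ (suc m) g h k = trans (cong (g 0 k ℚ.+ h 0 k ℚ.+_) (∑<-⊕ m (g ∘ suc) (h ∘ suc) k))
  (interchange (g 0 k) (h 0 k) (∑<-syntax m (g ∘ suc) k) (∑<-syntax m (h ∘ suc) k))
  where
  interchange : ∀ a b c d → (a ℚ.+ b) ℚ.+ (c ℚ.+ d) ≡ (a ℚ.+ c) ℚ.+ (b ℚ.+ d)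
  interchange = solve-∀ ℚ-ring

∑<-homo : ∀ {φ} → Additive φ → ∀ m (g : ℕ → Coeffs) → ∑[ i < m ] φ (g i) ≗ φ (∑[ i < m ] g i)
∑<-homo φ-add zero g = ≗.sym (Additive.homo-0 φ-add)
∑<-homo {φ} φ-add (suc m) g = ≗.trans (⊕-congˡ (φ (g 0)) (∑<-homo φ-add m (g ∘ suc))) (≗.sym (Additive.homo-⊕ φ-add (g 0) _))

∑<-last : ∀ m (g : ℕ → Coeffs) → ∑[ i < suc m ] g i ≗ ∑[ i < m ] g i ⊕ g m
∑<-last zero g = ≗.trans (⊕-identityʳ (g 0)) (≗.sym (⊕-identityˡ (g 0)))
∑<-last (suc m) g = ≗.trans (⊕-congˡ (g 0) (∑<-last m (g ∘ suc))) (≗.sym (⊕-assoc (g 0) _ _))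

∑∈-cong : ∀ {A : Set} {P : A → Set} {xs : List A} {g h : A → Coeffs} → All P xs → (∀ x → P x → g x ≗ h x) →
  ∑[ x ∈ xs ] g x ≗ ∑[ x ∈ xs ] h x
∑∈-cong [] g≗h k = refl
∑∈-cong (px ∷ pxs) g≗h = ⊕-cong (g≗h _ px) (∑∈-cong pxs g≗h)

∑∈-homo : ∀ {φ} → Additive φ → ∀ {A : Set} (xs : List A) (g : A → Coeffs) →
  ∑[ x ∈ xs ] φ (g x) ≗ φ (∑[ x ∈ xs ] g x)
∑∈-homo φ-add [] g = ≗.sym (Additive.homo-0 φ-add)
∑∈-homo {φ} φ-add (x ∷ xs) g = ≗.trans (⊕-congˡ (φ (g x)) (∑∈-homo φ-add xs g)) (≗.sym (Additive.homo-⊕ φ-add (g x) _))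

∑∈-++ : ∀ {A : Set} (xs ys : List A) (g : A → Coeffs) → ∑[ x ∈ xs ++ ys ] g x ≗ ∑[ x ∈ xs ] g x ⊕ ∑[ x ∈ ys ] g x
∑∈-++ [] ys g = ≗.sym (⊕-identityˡ _)
∑∈-++ (x ∷ xs) ys g = ≗.trans (⊕-congˡ (g x) (∑∈-++ xs ys g)) (≗.sym (⊕-assoc (g x) _ _))

∑∈-map : ∀ {A B : Set} (f : A → B) (xs : List A) (g : B → Coeffs) → ∑[ y ∈ map f xs ] g y ≗ ∑[ x ∈ xs ] g (f x)
∑∈-map f [] g k = refl
∑∈-map f (x ∷ xs) g = ⊕-congˡ (g (f x)) (∑∈-map f xs g)

∑∈-concatMap : ∀ {A B : Set} (f : A → List B) (xs : List A) (g : B → Coeffs) →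
  ∑[ y ∈ concatMap f xs ] g y ≗ ∑[ x ∈ xs ] ∑[ y ∈ f x ] g y
∑∈-concatMap f [] g k = refl
∑∈-concatMap f (x ∷ xs) g = ≗.trans (∑∈-++ (f x) (concatMap f xs) g) (⊕-congˡ (∑[ y ∈ f x ] g y) (∑∈-concatMap f xs g))

∑∈-applyUpTo : ∀ (f : ℕ → ℕ) m (g : ℕ → Coeffs) → ∑[ i ∈ applyUpTo f m ] g i ≗ ∑[ i < m ] g (f i)
∑∈-applyUpTo f zero g k = refl
∑∈-applyUpTo f (suc m) g = ⊕-congˡ (g (f 0)) (∑∈-applyUpTo (f ∘ suc) m g)

coeff-addP : ∀ p q → coeff (addP p q) ≗ coeff p ⊕ coeff q
coeff-addP [] q k = sym (ℚP.+-identityˡ _)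
coeff-addP (a ∷ p) [] k = sym (ℚP.+-identityʳ _)
coeff-addP (a ∷ p) (b ∷ q) zero = refl
coeff-addP (a ∷ p) (b ∷ q) (suc k) = coeff-addP p q k

coeff-scaleP : ∀ c p → coeff (scaleP c p) ≗ c ⊙ coeff p
coeff-scaleP c [] k = sym (ℚP.*-zeroʳ c)
coeff-scaleP c (a ∷ p) zero = refl
coeff-scaleP c (a ∷ p) (suc k) = coeff-scaleP c p k

coeff-0∷ : ∀ p → coeff (0ℚ ∷ p) ≗ t· coeff p
coeff-0∷ p zero = refl
coeff-0∷ p (suc k) = refl

coeff-mulP-∷ : ∀ a p q → coeff (mulP (a ∷ p) q) ≗ a ⊙ coeff q ⊕ t· coeff (mulP p q)
coeff-mulP-∷ a p q = ≗.trans (coeff-addP (scaleP a q) _) (⊕-cong (coeff-scaleP a q) (coeff-0∷ (mulP p q)))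

coeff-sumP : ∀ {A : Set} (xs : List A) (g : A → Poly) → coeff (sumP (map g xs)) ≗ ∑[ x ∈ xs ] coeff (g x)
coeff-sumP [] g k = refl
coeff-sumP (x ∷ xs) g = ≗.trans (coeff-addP (g x) _) (⊕-congˡ (coeff (g x)) (coeff-sumP xs g))

coeff-monomial-* : ∀ a b l → coeff (monomial (a ℚ.* b) l) ≗ a ⊙ coeff (monomial b l)
coeff-monomial-* a b zero zero = refl
coeff-monomial-* a b zero (suc k) = sym (ℚP.*-zeroʳ a)
coeff-monomial-* a b (suc l) zero = sym (ℚP.*-zeroʳ a)
coeff-monomial-* a b (suc l) (suc k) = coeff-monomial-* a b l k

infixr 7 [t+_]·_

[t+_]·_ : ℚ → Coeffs → Coeffs
[t+ c ]· f = t· f ⊕ c ⊙ f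

[t+]-cong : ∀ c {f g} → f ≗ g → [t+ c ]· f ≗ [t+ c ]· g
[t+]-cong c f≗g = ⊕-cong (t·-cong f≗g) (⊙-congʳ c f≗g)

[t+]-comm : ∀ a b f → [t+ a ]· [t+ b ]· f ≗ [t+ b ]· [t+ a ]· f
[t+]-comm a b f zero = swap₀ a b (f 0)
  where
  swap₀ : ∀ a b x → 0ℚ ℚ.+ a ℚ.* (0ℚ ℚ.+ b ℚ.* x) ≡ 0ℚ ℚ.+ b ℚ.* (0ℚ ℚ.+ a ℚ.* x)
  swap₀ = solve-∀ ℚ-ring
[t+]-comm a b f (suc zero) = swap₁ a b (f 0) (f 1)
  where
  swap₁ : ∀ a b x y → (0ℚ ℚ.+ b ℚ.* x) ℚ.+ a ℚ.* (x ℚ.+ b ℚ.* y) ≡ (0ℚ ℚ.+ a ℚ.* x) ℚ.+ b ℚ.* (x ℚ.+ a ℚ.* y)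
  swap₁ = solve-∀ ℚ-ring
[t+]-comm a b f (suc (suc k)) = swap₂ a b (f k) (f (suc k)) (f (suc (suc k)))
  where
  swap₂ : ∀ a b x y z → (x ℚ.+ b ℚ.* y) ℚ.+ a ℚ.* (y ℚ.+ b ℚ.* z) ≡ (x ℚ.+ a ℚ.* y) ℚ.+ b ℚ.* (y ℚ.+ a ℚ.* z)
  swap₂ = solve-∀ ℚ-ring

coeff-mulP-linear : ∀ c q → coeff (mulP (c ∷ 1ℚ ∷ []) q) ≗ [t+ c ]· coeff q
coeff-mulP-linear c q = begin
  coeff (mulP (c ∷ 1ℚ ∷ []) q)
    ≈⟨ coeff-mulP-∷ c [ 1ℚ ] q ⟩
  c ⊙ coeff q ⊕ t· coeff (mulP [ 1ℚ ] q)
    ≈⟨ ⊕-congˡ (c ⊙ coeff q) (t·-cong (coeff-mulP-∷ 1ℚ [] q)) ⟩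
  c ⊙ coeff q ⊕ t· (1ℚ ⊙ coeff q ⊕ t· 0ᶜ)
    ≈⟨ ⊕-congˡ (c ⊙ coeff q) (t·-cong (⊕-cong (⊙-identityˡ (coeff q)) t·-zero)) ⟩
  c ⊙ coeff q ⊕ t· (coeff q ⊕ 0ᶜ)
    ≈⟨ ⊕-congˡ (c ⊙ coeff q) (t·-cong (⊕-identityʳ (coeff q))) ⟩
  c ⊙ coeff q ⊕ t· coeff q
    ≈⟨ ⊕-comm (c ⊙ coeff q) (t· coeff q) ⟩
  [t+ c ]· coeff q ∎
  where open ≗-Reasoning

ρ : ℕ → ℚ
ρ j = ℕtoℚ (j * (j ∸ 1))

Q : ℕ → Coeffs
Q zero = 1ᶜ
Q (suc m) = [t+ ρ (suc m) ]· Q m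

linearProduct : List ℕ → Coeffs → Coeffs
linearProduct js f = foldr (λ j → [t+ ρ j ]·_) f js

linearProduct-[t+] : ∀ js c f → linearProduct js ([t+ c ]· f) ≗ [t+ c ]· linearProduct js f
linearProduct-[t+] [] c f = ≗.refl
linearProduct-[t+] (j ∷ js) c f = ≗.trans ([t+]-cong (ρ j) (linearProduct-[t+] js c f)) ([t+]-comm (ρ j) c (linearProduct js f))

linearProduct≗Q : ∀ m → linearProduct (applyUpTo suc m) 1ᶜ ≗ Q m
linearProduct≗Q zero = ≗.refl
linearProduct≗Q (suc m) = begin
  linearProduct (applyUpTo suc (suc m)) 1ᶜ
    ≡⟨ cong (λ js → linearProduct js 1ᶜ) (List.applyUpTo-∷ʳ suc m) ⟨
  linearProduct (applyUpTo suc m ∷ʳ suc m) 1ᶜ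
    ≡⟨ List.foldr-∷ʳ (λ j → [t+ ρ j ]·_) 1ᶜ (suc m) (applyUpTo suc m) ⟩
  linearProduct (applyUpTo suc m) ([t+ ρ (suc m) ]· 1ᶜ)
    ≈⟨ linearProduct-[t+] (applyUpTo suc m) (ρ (suc m)) 1ᶜ ⟩
  [t+ ρ (suc m) ]· linearProduct (applyUpTo suc m) 1ᶜ
    ≈⟨ [t+]-cong (ρ (suc m)) (linearProduct≗Q m) ⟩
  Q (suc m) ∎
  where open ≗-Reasoning

coeff-prodP : ∀ js → coeff (prodP (map (λ j → ρ j ∷ 1ℚ ∷ []) js)) ≗ linearProduct js 1ᶜ
coeff-prodP [] zero = refl
coeff-prodP [] (suc k) = refl
coeff-prodP (j ∷ js) = ≗.trans (coeff-mulP-linear (ρ j) (prodP (map (λ j → ρ j ∷ 1ℚ ∷ []) js)))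
                               ([t+]-cong (ρ j) (coeff-prodP js))

coeff-rhs : ∀ n → coeff (rhs n) ≗ Q n
coeff-rhs n = ≗.trans (coeff-prodP (map suc (upTo n)))
  (subst (λ js → linearProduct js 1ᶜ ≗ Q n) (sym (List.map-upTo suc n)) (linearProduct≗Q n))

B : ℕ → Coeffs
B i = t· Q i

B-suc : ∀ i → B (suc i) ≗ t· B i ⊕ ρ (suc i) ⊙ B i
B-suc i = ≗.trans (t·-homo-⊕ (t· Q i) (ρ (suc i) ⊙ Q i)) (⊕-congˡ (t· B i) (t·-homo-⊙ (ρ (suc i)) (Q i)))

comb : ℕ → (ℕ → ℚ) → Coeffs
comb m a = ∑[ i < m ] a i ⊙ B i

comb-cong : ∀ m {a b : ℕ → ℚ} → (∀ i → i < m → a i ≡ b i) → comb m a ≗ comb m b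
comb-cong m a≡b = ∑<-cong m (λ i i<m → ⊙-cong (a≡b i i<m) ≗.refl)

comb-zero : ∀ m {a : ℕ → ℚ} → (∀ i → i < m → a i ≡ 0ℚ) → comb m a ≗ 0ᶜ
comb-zero m a≡0 = ∑<-zero m (λ i i<m → ≗.trans (⊙-cong (a≡0 i i<m) ≗.refl) (⊙-zeroˡ (B i)))

comb-⊕ : ∀ m a b → comb m a ⊕ comb m b ≗ comb m (λ i → a i ℚ.+ b i)
comb-⊕ m a b = ≗.trans (≗.sym (∑<-⊕ m (λ i → a i ⊙ B i) (λ i → b i ⊙ B i)))
                       (∑<-cong m λ i _ → ≗.sym (⊙-distribʳ-+ (a i) (b i) (B i)))

comb-⊙ : ∀ m c a → c ⊙ comb m a ≗ comb m (λ i → c ℚ.* a i)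
comb-⊙ m c a = ≗.trans (≗.sym (∑<-homo (⊙-additive c) m (λ i → a i ⊙ B i)))
                       (∑<-cong m λ i _ → ≗.sym (⊙-assoc c (a i) (B i)))

t·-comb : ∀ m a → a m ≡ 0ℚ → t· comb (suc m) a ≗ comb (suc m) (λ i → (t· a) i ℚ.- a i ℚ.* ρ (suc i))
t·-comb m a aₘ≡0 = begin
  t· comb (suc m) a
    ≈⟨ ≗.sym (∑<-homo t·-additive (suc m) (λ i → a i ⊙ B i)) ⟩
  ∑[ i < suc m ] t· (a i ⊙ B i)
    ≈⟨ ∑<-cong (suc m) (λ i _ → ≗.trans (t·-homo-⊙ (a i) (B i)) (expand i)) ⟩
  ∑[ i < suc m ] (a i ⊙ B (suc i) ⊕ (- (a i ℚ.* ρ (suc i))) ⊙ B i)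
    ≈⟨ ∑<-⊕ (suc m) (λ i → a i ⊙ B (suc i)) (λ i → (- (a i ℚ.* ρ (suc i))) ⊙ B i) ⟩
  ∑[ i < suc m ] a i ⊙ B (suc i) ⊕ comb (suc m) (λ i → - (a i ℚ.* ρ (suc i)))
    ≈⟨ ⊕-cong shifted ≗.refl ⟩
  comb (suc m) (t· a) ⊕ comb (suc m) (λ i → - (a i ℚ.* ρ (suc i)))
    ≈⟨ comb-⊕ (suc m) (t· a) (λ i → - (a i ℚ.* ρ (suc i))) ⟩
  comb (suc m) (λ i → (t· a) i ℚ.- a i ℚ.* ρ (suc i)) ∎
  where
  open ≗-Reasoning
  expand : ∀ i → a i ⊙ t· B i ≗ a i ⊙ B (suc i) ⊕ (- (a i ℚ.* ρ (suc i))) ⊙ B i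
  expand i k = trans (identity (a i) ((t· B i) k) (ρ (suc i)) (B i k))
                     (cong (λ x → a i ℚ.* x ℚ.+ (- (a i ℚ.* ρ (suc i))) ℚ.* B i k) (sym (B-suc i k)))
    where
    identity : ∀ a x c y → a ℚ.* x ≡ a ℚ.* (x ℚ.+ c ℚ.* y) ℚ.+ (- (a ℚ.* c)) ℚ.* y
    identity = solve-∀ ℚ-ring
  shifted : ∑[ i < suc m ] a i ⊙ B (suc i) ≗ comb (suc m) (t· a)
  shifted = begin
    ∑[ i < suc m ] a i ⊙ B (suc i)
      ≈⟨ ∑<-last m (λ i → a i ⊙ B (suc i)) ⟩
    ∑[ i < m ] a i ⊙ B (suc i) ⊕ a m ⊙ B (suc m)
      ≈⟨ ⊕-congˡ (∑[ i < m ] a i ⊙ B (suc i)) (≗.trans (⊙-cong aₘ≡0 ≗.refl) (⊙-zeroˡ (B (suc m)))) ⟩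
    ∑[ i < m ] a i ⊙ B (suc i) ⊕ 0ᶜ
      ≈⟨ ⊕-identityʳ _ ⟩
    ∑[ i < m ] a i ⊙ B (suc i)
      ≈⟨ ≗.sym (⊕-identityˡ _) ⟩
    0ᶜ ⊕ ∑[ i < m ] a i ⊙ B (suc i)
      ≈⟨ ⊕-cong (≗.sym (⊙-zeroˡ (B 0))) ≗.refl ⟩
    comb (suc m) (t· a) ∎

-- κ m i = ∏_{j=i+2}^{m} j(j−1), the coordinate of B i in Q m.
κ : ℕ → ℕ → ℚ
κ m i = frac (m ! * (m ∸ 1) !) (suc i ! * i !)

Q≗comb : ∀ m → Q (suc m) ≗ comb (suc m) (κ (suc m))
Q≗comb zero k = base ((t· 1ᶜ) k) (1ᶜ k)
  where
  base : ∀ x y → x ℚ.+ 0ℚ ℚ.* y ≡ 1ℚ ℚ.* x ℚ.+ 0ℚ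
  base = solve-∀ ℚ-ring
Q≗comb (suc m) = begin
  t· Q (suc m) ⊕ ρ (suc (suc m)) ⊙ Q (suc m)
    ≈⟨ ⊕-congˡ (B (suc m)) (⊙-congʳ (ρ (suc (suc m))) (Q≗comb m)) ⟩
  B (suc m) ⊕ ρ (suc (suc m)) ⊙ comb (suc m) (κ (suc m))
    ≈⟨ ⊕-congˡ (B (suc m)) (comb-⊙ (suc m) (ρ (suc (suc m))) (κ (suc m))) ⟩
  B (suc m) ⊕ comb (suc m) (λ i → ρ (suc (suc m)) ℚ.* κ (suc m) i)
    ≈⟨ ⊕-congˡ (B (suc m)) (comb-cong (suc m) λ i _ → κ-step i) ⟩
  B (suc m) ⊕ comb (suc m) (κ (suc (suc m)))
    ≈⟨ ⊕-comm (B (suc m)) _ ⟩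
  comb (suc m) (κ (suc (suc m))) ⊕ B (suc m)
    ≈⟨ ⊕-congˡ (comb (suc m) (κ (suc (suc m)))) (≗.sym (≗.trans (⊙-cong κ-diag ≗.refl) (⊙-identityˡ (B (suc m))))) ⟩
  comb (suc m) (κ (suc (suc m))) ⊕ κ (suc (suc m)) (suc m) ⊙ B (suc m)
    ≈⟨ ≗.sym (∑<-last (suc m) (λ i → κ (suc (suc m)) i ⊙ B i)) ⟩
  comb (suc (suc m)) (κ (suc (suc m))) ∎
  where
  open ≗-Reasoning
  κ-step : ∀ i → ρ (suc (suc m)) ℚ.* κ (suc m) i ≡ κ (suc (suc m)) i
  κ-step i = sym (trans (cong (λ a → frac a (suc i ! * i !)) (factorials m (suc m !) (m !)))
                        (frac-*ˡ (suc (suc m) * suc m) (suc m ! * m !) (suc i ! * i !)))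
    where
    factorials : ∀ m a b → suc (suc m) * a * (suc m * b) ≡ suc (suc m) * suc m * (a * b)
    factorials = ℕ-Solver.solve-∀
  κ-diag : κ (suc (suc m)) (suc m) ≡ 1ℚ
  κ-diag = trans (frac≡ℕtoℚ*frac1 D D)
                 (trans (ℚP.*-comm (ℕtoℚ D) (frac 1 D)) (frac1*ℕtoℚ≡1 D {{ℕP._!*_!≢0 (suc (suc m)) (suc m)}}))
    where D = suc (suc m) ! * suc m !

-- Partial sums of compositions

properPartialSums-∷ʳ : ∀ z zs x → properPartialSums ((z ∷ zs) ∷ʳ x) ≡ properPartialSums (z ∷ zs) ∷ʳ sum (z ∷ zs)
properPartialSums-∷ʳ z [] x = cong [_] (sym (ℕP.+-identityʳ z))
properPartialSums-∷ʳ z (w ∷ ws) x = cong (z ∷_) (begin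
  map (z +_) (properPartialSums ((w ∷ ws) ∷ʳ x))
    ≡⟨ cong (map (z +_)) (properPartialSums-∷ʳ w ws x) ⟩
  map (z +_) (properPartialSums (w ∷ ws) ∷ʳ sum (w ∷ ws))
    ≡⟨ List.map-++ (z +_) (properPartialSums (w ∷ ws)) _ ⟩
  map (z +_) (properPartialSums (w ∷ ws)) ∷ʳ (z + sum (w ∷ ws)) ∎)
  where open ≡-Reasoning

properPartialSums-reverse : ∀ p → properPartialSums (reverse p) ≡ reverse (map (sum p ∸_) (properPartialSums p))
properPartialSums-reverse [] = refl
properPartialSums-reverse (x ∷ []) = refl
properPartialSums-reverse (x ∷ y ∷ ys) = begin
  properPartialSums (reverse (x ∷ y ∷ ys))
    ≡⟨ cong properPartialSums (List.unfold-reverse x (y ∷ ys)) ⟩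
  properPartialSums (reverse (y ∷ ys) ∷ʳ x)
    ≡⟨ properPartialSums-∷ʳ′ (reverse (y ∷ ys)) (List.unfold-reverse y ys) ⟩
  properPartialSums (reverse (y ∷ ys)) ∷ʳ sum (reverse (y ∷ ys))
    ≡⟨ cong₂ _∷ʳ_ (properPartialSums-reverse (y ∷ ys)) (sum-↭ (↭-reverse (y ∷ ys))) ⟩
  reverse (map (S ∸_) P) ∷ʳ S
    ≡⟨ List.unfold-reverse S (map (S ∸_) P) ⟨
  reverse (S ∷ map (S ∸_) P)
    ≡⟨ cong reverse (cong₂ _∷_ (ℕP.m+n∸m≡n x S) shifted) ⟨
  reverse (map (x + S ∸_) (x ∷ map (x +_) P)) ∎
  where
  open ≡-Reasoning
  S = sum (y ∷ ys)
  P = properPartialSums (y ∷ ys)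
  properPartialSums-∷ʳ′ : ∀ zs → zs ≡ reverse ys ∷ʳ y → properPartialSums (zs ∷ʳ x) ≡ properPartialSums zs ∷ʳ sum zs
  properPartialSums-∷ʳ′ zs refl with reverse ys
  ... | [] = properPartialSums-∷ʳ y [] x
  ... | w ∷ ws = properPartialSums-∷ʳ w (ws ∷ʳ y) x
  shifted : map (x + S ∸_) (map (x +_) P) ≡ map (S ∸_) P
  shifted = trans (sym (List.map-∘ P)) (List.map-cong (ℕP.[m+n]∸[m+o]≡n∸o x S) P)

s-reverse : ∀ p → s (reverse p) ≡ product (map (sum p ∸_) (properPartialSums p))
s-reverse p = trans (cong product (properPartialSums-reverse p)) (product-↭ (↭-reverse (map (sum p ∸_) (properPartialSums p))))

compositionsFuel-sum : ∀ f m → All (λ q → sum q ≡ m) (compositionsFuel f m)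
compositionsFuel-sum f zero = refl ∷ []
compositionsFuel-sum zero (suc m) = []
compositionsFuel-sum (suc f) (suc m) = All.concat⁺ (All.map⁺ (All.applyUpTo⁺₁ id (suc m) λ {k} k≤m →
  All.map⁺ (All.map (λ {q} Σq≡m∸k → cong suc (trans (cong (k +_) Σq≡m∸k) (ℕP.m+[n∸m]≡n (ℕP.≤-pred k≤m))))
                    (compositionsFuel-sum f (m ∸ k)))))

module Compositions (n : ℕ) where

  w : ℕ → ℚ
  w σ = frac 1 (σ * (n ∸ σ))

  -- weight a q is the weight of q as the tail of a composition of n whose earlier parts sum to a.
  weight : ℕ → List ℕ → ℚ
  weight a q = ℕtoℚ (product q) ℚ.* productℚ (map (λ σ → w (a + σ)) (properPartialSums q))

  term : ℕ → List ℕ → Coeffs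
  term a q = coeff (monomial (weight a q) (length q))

  weight-∷∷ : ∀ a c q₀ qs → weight a (c ∷ q₀ ∷ qs) ≡ (ℕtoℚ c ℚ.* w (a + c)) ℚ.* weight (a + c) (q₀ ∷ qs)
  weight-∷∷ a c q₀ qs = begin
    ℕtoℚ (c * product (q₀ ∷ qs)) ℚ.* (w (a + c) ℚ.* productℚ (map (λ σ → w (a + σ)) (map (c +_) P)))
      ≡⟨ cong₂ (λ x y → x ℚ.* (w (a + c) ℚ.* productℚ y)) (ℕtoℚ-homo-* c (product (q₀ ∷ qs))) reindex ⟩
    (ℕtoℚ c ℚ.* ℕtoℚ (product (q₀ ∷ qs))) ℚ.* (w (a + c) ℚ.* productℚ (map (λ σ → w (a + c + σ)) P))
      ≡⟨ regroup (ℕtoℚ c) (ℕtoℚ (product (q₀ ∷ qs))) (w (a + c)) (productℚ (map (λ σ → w (a + c + σ)) P)) ⟩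
    (ℕtoℚ c ℚ.* w (a + c)) ℚ.* weight (a + c) (q₀ ∷ qs) ∎
    where
    open ≡-Reasoning
    P = properPartialSums (q₀ ∷ qs)
    reindex : map (λ σ → w (a + σ)) (map (c +_) P) ≡ map (λ σ → w (a + c + σ)) P
    reindex = trans (sym (List.map-∘ P)) (List.map-cong (λ σ → cong w (sym (ℕP.+-assoc a c σ))) P)
    regroup : ∀ x y z u → (x ℚ.* y) ℚ.* (z ℚ.* u) ≡ (x ℚ.* z) ℚ.* (y ℚ.* u)
    regroup = solve-∀ ℚ-ring

  term-∷∷ : ∀ a c q₀ qs → term a (c ∷ q₀ ∷ qs) ≗ (ℕtoℚ c ℚ.* w (a + c)) ⊙ t· term (a + c) (q₀ ∷ qs)
  term-∷∷ a c q₀ qs k = begin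
    coeff (monomial (weight a (c ∷ q₀ ∷ qs)) (suc l)) k
      ≡⟨ cong (λ x → coeff (monomial x (suc l)) k) (weight-∷∷ a c q₀ qs) ⟩
    coeff (monomial (α ℚ.* weight (a + c) (q₀ ∷ qs)) (suc l)) k
      ≡⟨ coeff-monomial-* α _ (suc l) k ⟩
    α ℚ.* coeff (0ℚ ∷ monomial (weight (a + c) (q₀ ∷ qs)) l) k
      ≡⟨ cong (α ℚ.*_) (coeff-0∷ _ k) ⟩
    α ℚ.* (t· term (a + c) (q₀ ∷ qs)) k ∎
    where
    open ≡-Reasoning
    α = ℕtoℚ c ℚ.* w (a + c)
    l = length (q₀ ∷ qs)

  term-[c] : ∀ a c → term a [ c ] ≗ ℕtoℚ c ⊙ t· 1ᶜ
  term-[c] a c zero = sym (ℚP.*-zeroʳ (ℕtoℚ c))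
  term-[c] a c (suc zero) = trans (ℚP.*-identityʳ _) (trans (cong ℕtoℚ (ℕP.*-identityʳ c)) (sym (ℚP.*-identityʳ (ℕtoℚ c))))
  term-[c] a c (suc (suc k)) = sym (ℚP.*-zeroʳ (ℕtoℚ c))

  -- V r will be the sum of term (n − r) over the compositions of r (∑compositions≗V); U and h are
  -- its first and second differences, which makes the recursion structural.
  mutual
    h : ℕ → Coeffs
    h zero = t· 1ᶜ
    h (suc j) = w (n ∸ suc j) ⊙ t· V (suc j)

    U : ℕ → Coeffs
    U zero = 0ᶜ
    U (suc m) = U m ⊕ h m

    V : ℕ → Coeffs
    V zero = 0ᶜ
    V (suc m) = V m ⊕ U (suc m)

  ∑h≗U : ∀ m → ∑[ k < suc m ] h (m ∸ k) ≗ U (suc m)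
  ∑h≗U zero = ≗.trans (⊕-identityʳ (h 0)) (≗.sym (⊕-identityˡ (h 0)))
  ∑h≗U (suc m) = ≗.trans (⊕-congˡ (h (suc m)) (∑h≗U m)) (⊕-comm (h (suc m)) (U (suc m)))

  ∑[1+k]h≗V : ∀ m → ∑[ k < suc m ] ℕtoℚ (suc k) ⊙ h (m ∸ k) ≗ V (suc m)
  ∑[1+k]h≗V zero x = cancel (h 0 x)
    where
    cancel : ∀ a → 1ℚ ℚ.* a ℚ.+ 0ℚ ≡ 0ℚ ℚ.+ (0ℚ ℚ.+ a)
    cancel = solve-∀ ℚ-ring
  ∑[1+k]h≗V (suc m) = begin
    1ℚ ⊙ h (suc m) ⊕ ∑[ k < suc m ] ℕtoℚ (suc (suc k)) ⊙ h (m ∸ k)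
      ≈⟨ ⊕-congˡ (1ℚ ⊙ h (suc m)) (∑<-cong (suc m) λ k _ → split k) ⟩
    1ℚ ⊙ h (suc m) ⊕ ∑[ k < suc m ] (h (m ∸ k) ⊕ ℕtoℚ (suc k) ⊙ h (m ∸ k))
      ≈⟨ ⊕-congˡ (1ℚ ⊙ h (suc m)) (∑<-⊕ (suc m) (λ k → h (m ∸ k)) (λ k → ℕtoℚ (suc k) ⊙ h (m ∸ k))) ⟩
    1ℚ ⊙ h (suc m) ⊕ (∑[ k < suc m ] h (m ∸ k) ⊕ ∑[ k < suc m ] ℕtoℚ (suc k) ⊙ h (m ∸ k))
      ≈⟨ ⊕-congˡ (1ℚ ⊙ h (suc m)) (⊕-cong (∑h≗U m) (∑[1+k]h≗V m)) ⟩
    1ℚ ⊙ h (suc m) ⊕ (U (suc m) ⊕ V (suc m))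
      ≈⟨ (λ x → rotate (h (suc m) x) (U (suc m) x) (V (suc m) x)) ⟩
    V (suc (suc m)) ∎
    where
    open ≗-Reasoning
    split : ∀ k → ℕtoℚ (suc (suc k)) ⊙ h (m ∸ k) ≗ h (m ∸ k) ⊕ ℕtoℚ (suc k) ⊙ h (m ∸ k)
    split k = ≗.trans (⊙-cong (ℕtoℚ-homo-+ 1 (suc k)) ≗.refl)
                (≗.trans (⊙-distribʳ-+ 1ℚ (ℕtoℚ (suc k)) (h (m ∸ k))) (⊕-cong (⊙-identityˡ (h (m ∸ k))) ≗.refl))
    rotate : ∀ a b c → 1ℚ ℚ.* a ℚ.+ (b ℚ.+ c) ≡ c ℚ.+ (b ℚ.+ a)
    rotate = solve-∀ ℚ-ring

  mutual
    ∑compositions≗V : ∀ f m a → m ≤ f → a + suc m ≡ n →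
      ∑[ q ∈ compositionsFuel (suc f) (suc m) ] term a q ≗ V (suc m)
    ∑compositions≗V f m a m≤f a+m+1≡n = begin
      ∑[ q ∈ compositionsFuel (suc f) (suc m) ] term a q
        ≈⟨ ∑∈-concatMap startingWith (upTo (suc m)) (term a) ⟩
      ∑[ k ∈ upTo (suc m) ] (∑[ q ∈ startingWith k ] term a q)
        ≈⟨ ∑∈-applyUpTo id (suc m) (λ k → ∑[ q ∈ startingWith k ] term a q) ⟩
      ∑[ k < suc m ] (∑[ q ∈ startingWith k ] term a q)
        ≈⟨ ∑<-cong (suc m) (λ k k≤m → firstPart k (ℕP.≤-pred k≤m)) ⟩
      ∑[ k < suc m ] ℕtoℚ (suc k) ⊙ h (m ∸ k)
        ≈⟨ ∑[1+k]h≗V m ⟩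
      V (suc m) ∎
      where
      open ≗-Reasoning
      startingWith : ℕ → List (List ℕ)
      startingWith k = map (suc k ∷_) (compositionsFuel f (m ∸ k))
      offset : ∀ k → k ≤ m → a + suc k + (m ∸ k) ≡ n
      offset k k≤m = trans (ℕP.+-assoc a (suc k) (m ∸ k)) (trans (cong (λ x → a + suc x) (ℕP.m+[n∸m]≡n k≤m)) a+m+1≡n)
      firstPart : ∀ k → k ≤ m → ∑[ q ∈ startingWith k ] term a q ≗ ℕtoℚ (suc k) ⊙ h (m ∸ k)
      firstPart k k≤m = ≗.trans (∑∈-map (suc k ∷_) (compositionsFuel f (m ∸ k)) (term a))
                                (∑firstPart≗h f (m ∸ k) k a (ℕP.≤-trans (ℕP.m∸n≤m m k) m≤f) (offset k k≤m))

    ∑firstPart≗h : ∀ f r k a → r ≤ f → a + suc k + r ≡ n →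
      ∑[ q ∈ compositionsFuel f r ] term a (suc k ∷ q) ≗ ℕtoℚ (suc k) ⊙ h r
    ∑firstPart≗h f zero k a _ _ = ≗.trans (⊕-identityʳ _) (term-[c] a (suc k))
    ∑firstPart≗h (suc f) (suc j) k a (s≤s j≤f) a+k+j+2≡n = begin
      ∑[ q ∈ qs ] term a (suc k ∷ q)
        ≈⟨ ∑∈-cong (compositionsFuel-sum (suc f) (suc j)) peel ⟩
      ∑[ q ∈ qs ] α ⊙ t· term (a + suc k) q
        ≈⟨ ∑∈-homo (⊙-additive α) qs (λ q → t· term (a + suc k) q) ⟩
      α ⊙ (∑[ q ∈ qs ] t· term (a + suc k) q)
        ≈⟨ ⊙-congʳ α (∑∈-homo t·-additive qs (term (a + suc k))) ⟩
      α ⊙ t· (∑[ q ∈ qs ] term (a + suc k) q)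
        ≈⟨ ⊙-congʳ α (t·-cong (∑compositions≗V f j (a + suc k) j≤f a+k+j+2≡n)) ⟩
      α ⊙ t· V (suc j)
        ≈⟨ ⊙-assoc (ℕtoℚ (suc k)) (w (a + suc k)) (t· V (suc j)) ⟩
      ℕtoℚ (suc k) ⊙ w (a + suc k) ⊙ t· V (suc j)
        ≡⟨ cong (λ x → ℕtoℚ (suc k) ⊙ w x ⊙ t· V (suc j)) a+k+1≡n∸[j+1] ⟩
      ℕtoℚ (suc k) ⊙ h (suc j) ∎
      where
      open ≗-Reasoning
      qs = compositionsFuel (suc f) (suc j)
      α = ℕtoℚ (suc k) ℚ.* w (a + suc k)
      peel : ∀ q → sum q ≡ suc j → term a (suc k ∷ q) ≗ α ⊙ t· term (a + suc k) q
      peel (q₀ ∷ q) _ = term-∷∷ a (suc k) q₀ q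
      a+k+1≡n∸[j+1] : a + suc k ≡ n ∸ suc j
      a+k+1≡n∸[j+1] = trans (sym (ℕP.m+n∸n≡m (a + suc k) (suc j))) (cong (_∸ suc j) a+k+j+2≡n)

  frac1-s*frac1-s-reverse : ∀ p → sum p ≡ n → frac 1 (s p) ℚ.* frac 1 (s (reverse p)) ≡ productℚ (map w (properPartialSums p))
  frac1-s*frac1-s-reverse p Σp≡n = begin
    frac 1 (s p) ℚ.* frac 1 (s (reverse p))
      ≡⟨ cong (λ x → frac 1 (s p) ℚ.* frac 1 x) (trans (s-reverse p) (cong (λ m → product (map (m ∸_) P)) Σp≡n)) ⟩
    frac 1 (product P) ℚ.* frac 1 (product (map (n ∸_) P))
      ≡⟨ cong₂ ℚ._*_ (frac1-homo-product P) (trans (frac1-homo-product (map (n ∸_) P)) (cong productℚ (sym (List.map-∘ P)))) ⟩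
    productℚ (map (frac 1) P) ℚ.* productℚ (map (λ σ → frac 1 (n ∸ σ)) P)
      ≡⟨ productℚ-map-* (frac 1) (λ σ → frac 1 (n ∸ σ)) P ⟩
    productℚ (map (λ σ → frac 1 σ ℚ.* frac 1 (n ∸ σ)) P)
      ≡⟨ cong productℚ (List.map-cong (λ σ → sym (frac1-homo-* σ (n ∸ σ))) P) ⟩
    productℚ (map w P) ∎
    where
    open ≡-Reasoning
    P = properPartialSums p

  F : ℚ
  F = ℕtoℚ ((n ∸ 1) !)

  lhsWeight : List ℕ → ℚ
  lhsWeight p = frac ((n ∸ 1) !) (s p) ℚ.* frac ((n ∸ 1) !) (s (reverse p)) ℚ.* ℕtoℚ (product p)

  lhsWeight≡F*F*weight : ∀ p → sum p ≡ n → lhsWeight p ≡ F ℚ.* (F ℚ.* weight 0 p)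
  lhsWeight≡F*F*weight p Σp≡n = begin
    lhsWeight p
      ≡⟨ cong₂ (λ x y → x ℚ.* y ℚ.* ℕtoℚ (product p)) (frac≡ℕtoℚ*frac1 _ (s p)) (frac≡ℕtoℚ*frac1 _ (s (reverse p))) ⟩
    (F ℚ.* frac 1 (s p)) ℚ.* (F ℚ.* frac 1 (s (reverse p))) ℚ.* ℕtoℚ (product p)
      ≡⟨ regroup F (frac 1 (s p)) (frac 1 (s (reverse p))) (ℕtoℚ (product p)) ⟩
    F ℚ.* (F ℚ.* (ℕtoℚ (product p) ℚ.* (frac 1 (s p) ℚ.* frac 1 (s (reverse p)))))
      ≡⟨ cong (λ x → F ℚ.* (F ℚ.* (ℕtoℚ (product p) ℚ.* x))) (frac1-s*frac1-s-reverse p Σp≡n) ⟩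
    F ℚ.* (F ℚ.* weight 0 p) ∎
    where
    open ≡-Reasoning
    regroup : ∀ f a b c → (f ℚ.* a) ℚ.* (f ℚ.* b) ℚ.* c ≡ f ℚ.* (f ℚ.* (c ℚ.* (a ℚ.* b)))
    regroup = solve-∀ ℚ-ring

  coeff-lhs : coeff (lhs n) ≗ F ⊙ F ⊙ (∑[ p ∈ compositions n ] term 0 p)
  coeff-lhs = begin
    coeff (lhs n)
      ≈⟨ coeff-sumP (compositions n) (λ p → monomial (lhsWeight p) (length p)) ⟩
    ∑[ p ∈ compositions n ] coeff (monomial (lhsWeight p) (length p))
      ≈⟨ ∑∈-cong (compositionsFuel-sum n n) rescale ⟩
    ∑[ p ∈ compositions n ] F ⊙ F ⊙ term 0 p
      ≈⟨ ∑∈-homo (⊙-additive F) (compositions n) (λ p → F ⊙ term 0 p) ⟩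
    F ⊙ (∑[ p ∈ compositions n ] F ⊙ term 0 p)
      ≈⟨ ⊙-congʳ F (∑∈-homo (⊙-additive F) (compositions n) (term 0)) ⟩
    F ⊙ F ⊙ (∑[ p ∈ compositions n ] term 0 p) ∎
    where
    open ≗-Reasoning
    rescale : ∀ p → sum p ≡ n → coeff (monomial (lhsWeight p) (length p)) ≗ F ⊙ F ⊙ term 0 p
    rescale p Σp≡n = ≗.trans (λ k → cong (λ x → coeff (monomial x (length p)) k) (lhsWeight≡F*F*weight p Σp≡n))
                     (≗.trans (coeff-monomial-* F _ (length p)) (⊙-congʳ F (coeff-monomial-* F (weight 0 p) (length p))))

module ClosedForm (n-1 : ℕ) where

  n : ℕ
  n = suc n-1

  open Compositions n

  w-symmetric : ∀ σ → σ ≤ n → w (n ∸ σ) ≡ w σ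
  w-symmetric σ σ≤n = cong (frac 1) (trans (cong ((n ∸ σ) *_) (ℕP.m∸[m∸n]≡n σ≤n)) (ℕP.*-comm (n ∸ σ) σ))

  w*ℕtoℚ≡1 : ∀ i → suc i < n → w (suc i) ℚ.* ℕtoℚ (suc i * (n ∸ suc i)) ≡ 1ℚ
  w*ℕtoℚ≡1 i i+1<n =
    frac1*ℕtoℚ≡1 (suc i * (n ∸ suc i)) {{ℕP.m*n≢0 (suc i) (n ∸ suc i) {{_}} {{ℕ.≢-nonZero (ℕP.m>n⇒m∸n≢0 i+1<n)}}}}

  β : ℕ → ℚ
  β zero = 1ℚ
  β (suc i) = β i ℚ.* w (suc i)

  β-unfold : ∀ i → suc i < n → β i ≡ β (suc i) ℚ.* ℕtoℚ (suc i * (n ∸ suc i))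
  β-unfold i i+1<n = sym (trans (ℚP.*-assoc (β i) (w (suc i)) _)
                               (trans (cong (β i ℚ.*_) (w*ℕtoℚ≡1 i i+1<n)) (ℚP.*-identityʳ (β i))))

  u v : ℕ → ℕ → ℚ
  u r i = β i ℚ.* ℕtoℚ (r C i)
  v r i = β i ℚ.* ℕtoℚ (r C suc i)

  U-one : U 1 ≗ comb n (u 0)
  U-one = ≗.trans (⊕-identityˡ (t· 1ᶜ))
    (≗.sym (≗.trans (⊕-congˡ (1ℚ ⊙ B 0) (∑<-zero n-1 λ i _ →
                                              ≗.trans (⊙-cong (ℚP.*-zeroʳ (β (suc i))) ≗.refl) (⊙-zeroˡ (B (suc i)))))
           (≗.trans (⊕-identityʳ (1ℚ ⊙ B 0)) (⊙-identityˡ (B 0)))))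

  V-zero : V 0 ≗ comb n (v 0)
  V-zero = ≗.sym (comb-zero n λ i _ → ℚP.*-zeroʳ (β i))

  V-step : ∀ r → V r ≗ comb n (v r) → U (suc r) ≗ comb n (u r) → V (suc r) ≗ comb n (v (suc r))
  V-step r V≗ U≗ = ≗.trans (⊕-cong V≗ U≗) (≗.trans (comb-⊕ n (v r) (u r)) (comb-cong n λ i _ → pascal i))
    where
    pascal : ∀ i → v r i ℚ.+ u r i ≡ v (suc r) i
    pascal i = begin
      β i ℚ.* ℕtoℚ (r C suc i) ℚ.+ β i ℚ.* ℕtoℚ (r C i)
        ≡⟨ ℚP.*-distribˡ-+ (β i) (ℕtoℚ (r C suc i)) (ℕtoℚ (r C i)) ⟨
      β i ℚ.* (ℕtoℚ (r C suc i) ℚ.+ ℕtoℚ (r C i))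
        ≡⟨ cong (β i ℚ.*_) (ℚP.+-comm (ℕtoℚ (r C suc i)) (ℕtoℚ (r C i))) ⟩
      β i ℚ.* (ℕtoℚ (r C i) ℚ.+ ℕtoℚ (r C suc i))
        ≡⟨ cong (β i ℚ.*_) (ℕtoℚ-homo-+ (r C i) (r C suc i)) ⟨
      β i ℚ.* ℕtoℚ (r C i + r C suc i)
        ≡⟨ cong (λ x → β i ℚ.* ℕtoℚ x) (nCk+nC[k+1]≡[n+1]C[k+1] r i) ⟩
      β i ℚ.* ℕtoℚ (suc r C suc i) ∎
      where open ≡-Reasoning

  U-coefficient : ∀ r i → suc r < n → i < n →
    u r i ℚ.+ w (n ∸ suc r) ℚ.* ((t· v (suc r)) i ℚ.- v (suc r) i ℚ.* ρ (suc i)) ≡ u (suc r) i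
  U-coefficient r zero r+1<n _ = drop (u r 0) (w (n ∸ suc r)) (v (suc r) 0)
    where
    drop : ∀ b ω a → b ℚ.+ ω ℚ.* (0ℚ ℚ.- a ℚ.* 0ℚ) ≡ b
    drop = solve-∀ ℚ-ring
  U-coefficient r (suc j) r+1<n j+1<n = begin
    b ℚ.* y ℚ.+ ω ℚ.* (β j ℚ.* x ℚ.- (b ℚ.* z) ℚ.* c)
      ≡⟨ cong (λ β′ → b ℚ.* y ℚ.+ ω ℚ.* (β′ ℚ.* x ℚ.- (b ℚ.* z) ℚ.* c)) (β-unfold j j+1<n) ⟩
    b ℚ.* y ℚ.+ ω ℚ.* ((b ℚ.* d) ℚ.* x ℚ.- (b ℚ.* z) ℚ.* c)
      ≡⟨ factor b y ω d x z c ⟩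
    b ℚ.* y ℚ.+ (ω ℚ.* b) ℚ.* (d ℚ.* x ℚ.- c ℚ.* z)
      ≡⟨ cong (λ t → b ℚ.* y ℚ.+ (ω ℚ.* b) ℚ.* (t ℚ.- c ℚ.* z)) weightedPascalℚ ⟩
    b ℚ.* y ℚ.+ (ω ℚ.* b) ℚ.* ((c ℚ.* z ℚ.+ e ℚ.* y′) ℚ.- c ℚ.* z)
      ≡⟨ cancel b y ω c z e y′ ⟩
    b ℚ.* y ℚ.+ b ℚ.* y′ ℚ.* (ω ℚ.* e)
      ≡⟨ cong (λ t → b ℚ.* y ℚ.+ b ℚ.* y′ ℚ.* t) ω*e≡1 ⟩
    b ℚ.* y ℚ.+ b ℚ.* y′ ℚ.* 1ℚ
      ≡⟨ collect b y y′ ⟩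
    b ℚ.* (y′ ℚ.+ y)
      ≡⟨ cong (b ℚ.*_) (ℕtoℚ-homo-+ (r C j) (r C suc j)) ⟨
    b ℚ.* ℕtoℚ (r C j + r C suc j)
      ≡⟨ cong (λ t → b ℚ.* ℕtoℚ t) (nCk+nC[k+1]≡[n+1]C[k+1] r j) ⟩
    b ℚ.* x ∎
    where
    open ≡-Reasoning
    b = β (suc j)
    ω = w (n ∸ suc r)
    x = ℕtoℚ (suc r C suc j)
    y = ℕtoℚ (r C suc j)
    y′ = ℕtoℚ (r C j)
    z = ℕtoℚ (suc r C suc (suc j))
    c = ρ (suc (suc j))
    d = ℕtoℚ (suc j * (n ∸ suc j))
    e = ℕtoℚ (suc r * (n ∸ suc r))
    weightedPascalℚ : d ℚ.* x ≡ c ℚ.* z ℚ.+ e ℚ.* y′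
    weightedPascalℚ = begin
      d ℚ.* x
        ≡⟨ ℕtoℚ-homo-* (suc j * (n ∸ suc j)) (suc r C suc j) ⟨
      ℕtoℚ (suc j * (n ∸ suc j) * (suc r C suc j))
        ≡⟨ cong ℕtoℚ (weightedPascal n r j (ℕP.<⇒≤ r+1<n)) ⟩
      ℕtoℚ (suc (suc j) * suc j * (suc r C suc (suc j)) + suc r * (n ∸ suc r) * (r C j))
        ≡⟨ ℕtoℚ-homo-+ (suc (suc j) * suc j * (suc r C suc (suc j))) (suc r * (n ∸ suc r) * (r C j)) ⟩
      ℕtoℚ (suc (suc j) * suc j * (suc r C suc (suc j))) ℚ.+ ℕtoℚ (suc r * (n ∸ suc r) * (r C j))
        ≡⟨ cong₂ ℚ._+_ (ℕtoℚ-homo-* (suc (suc j) * suc j) (suc r C suc (suc j))) (ℕtoℚ-homo-* (suc r * (n ∸ suc r)) (r C j)) ⟩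
      c ℚ.* z ℚ.+ e ℚ.* y′ ∎
    ω*e≡1 : ω ℚ.* e ≡ 1ℚ
    ω*e≡1 = trans (cong (ℚ._* e) (w-symmetric (suc r) (ℕP.<⇒≤ r+1<n))) (w*ℕtoℚ≡1 r r+1<n)
    factor : ∀ b y ω d x z c →
      b ℚ.* y ℚ.+ ω ℚ.* ((b ℚ.* d) ℚ.* x ℚ.- (b ℚ.* z) ℚ.* c) ≡ b ℚ.* y ℚ.+ (ω ℚ.* b) ℚ.* (d ℚ.* x ℚ.- c ℚ.* z)
    factor = solve-∀ ℚ-ring
    cancel : ∀ b y ω c z e y′ →
      b ℚ.* y ℚ.+ (ω ℚ.* b) ℚ.* ((c ℚ.* z ℚ.+ e ℚ.* y′) ℚ.- c ℚ.* z) ≡ b ℚ.* y ℚ.+ b ℚ.* y′ ℚ.* (ω ℚ.* e)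
    cancel = solve-∀ ℚ-ring
    collect : ∀ b y y′ → b ℚ.* y ℚ.+ b ℚ.* y′ ℚ.* 1ℚ ≡ b ℚ.* (y′ ℚ.+ y)
    collect = solve-∀ ℚ-ring

  U-step : ∀ r → suc r < n → V (suc r) ≗ comb n (v (suc r)) → U (suc r) ≗ comb n (u r) →
    U (suc (suc r)) ≗ comb n (u (suc r))
  U-step r r+1<n V≗ U≗ = begin
    U (suc r) ⊕ ω ⊙ t· V (suc r)
      ≈⟨ ⊕-cong U≗ (⊙-congʳ ω (t·-cong V≗)) ⟩
    comb n (u r) ⊕ ω ⊙ t· comb n (v (suc r))
      ≈⟨ ⊕-congˡ (comb n (u r)) (⊙-congʳ ω (t·-comb n-1 (v (suc r)) vanishes)) ⟩
    comb n (u r) ⊕ ω ⊙ comb n shifted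
      ≈⟨ ⊕-congˡ (comb n (u r)) (comb-⊙ n ω shifted) ⟩
    comb n (u r) ⊕ comb n (λ i → ω ℚ.* shifted i)
      ≈⟨ comb-⊕ n (u r) (λ i → ω ℚ.* shifted i) ⟩
    comb n (λ i → u r i ℚ.+ ω ℚ.* shifted i)
      ≈⟨ comb-cong n (λ i i<n → U-coefficient r i r+1<n i<n) ⟩
    comb n (u (suc r)) ∎
    where
    open ≗-Reasoning
    ω = w (n ∸ suc r)
    shifted : ℕ → ℚ
    shifted i = (t· v (suc r)) i ℚ.- v (suc r) i ℚ.* ρ (suc i)
    vanishes : v (suc r) n-1 ≡ 0ℚ
    vanishes = trans (cong (λ t → β n-1 ℚ.* ℕtoℚ t) (k>n⇒nCk≡0 r+1<n)) (ℚP.*-zeroʳ (β n-1))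

  closedForm : ∀ r → r < n → U (suc r) ≗ comb n (u r) × V (suc r) ≗ comb n (v (suc r))
  closedForm zero _ = U-one , V-step 0 V-zero U-one
  closedForm (suc r) r+1<n with closedForm r (ℕP.<-trans (ℕP.n<1+n r) r+1<n)
  ... | U≗ , V≗ = U≗′ , V-step (suc r) V≗ U≗′
    where U≗′ = U-step r r+1<n V≗ U≗

  V≗comb : V n ≗ comb n (v n)
  V≗comb = proj₂ (closedForm n-1 (ℕP.n<1+n n-1))

  β*[i!*[n-1]!]≡[n-1-i]! : ∀ i → i ≤ n-1 → β i ℚ.* ℕtoℚ (i ! * n-1 !) ≡ ℕtoℚ ((n-1 ∸ i) !)
  β*[i!*[n-1]!]≡[n-1-i]! zero _ = trans (ℚP.*-identityˡ _) (cong ℕtoℚ (ℕP.*-identityˡ (n-1 !)))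
  β*[i!*[n-1]!]≡[n-1-i]! (suc j) j<n-1 = begin
    β j ℚ.* w (suc j) ℚ.* ℕtoℚ (suc j * j ! * n-1 !)
      ≡⟨ cong (λ t → β j ℚ.* w (suc j) ℚ.* t) split ⟩
    β j ℚ.* w (suc j) ℚ.* (ℕtoℚ (suc j) ℚ.* ℕtoℚ (j ! * n-1 !))
      ≡⟨ regroup (β j) (w (suc j)) (ℕtoℚ (suc j)) (ℕtoℚ (j ! * n-1 !)) ⟩
    β j ℚ.* ℕtoℚ (j ! * n-1 !) ℚ.* (w (suc j) ℚ.* ℕtoℚ (suc j))
      ≡⟨ cong (ℚ._* (w (suc j) ℚ.* ℕtoℚ (suc j))) (β*[i!*[n-1]!]≡[n-1-i]! j (ℕP.<⇒≤ j<n-1)) ⟩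
    ℕtoℚ ((n-1 ∸ j) !) ℚ.* (w (suc j) ℚ.* ℕtoℚ (suc j))
      ≡⟨ cong (λ t → ℕtoℚ t ℚ.* (w (suc j) ℚ.* ℕtoℚ (suc j))) ([n-k]*[n-k-1]!≡[n-k]! j<n-1) ⟨
    ℕtoℚ ((n-1 ∸ j) * (n-1 ∸ suc j) !) ℚ.* (w (suc j) ℚ.* ℕtoℚ (suc j))
      ≡⟨ absorb ⟩
    ℕtoℚ ((n-1 ∸ suc j) !) ℚ.* (w (suc j) ℚ.* ℕtoℚ (suc j * (n ∸ suc j)))
      ≡⟨ cong (ℕtoℚ ((n-1 ∸ suc j) !) ℚ.*_) (w*ℕtoℚ≡1 j (s≤s j<n-1)) ⟩
    ℕtoℚ ((n-1 ∸ suc j) !) ℚ.* 1ℚ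
      ≡⟨ ℚP.*-identityʳ _ ⟩
    ℕtoℚ ((n-1 ∸ suc j) !) ∎
    where
    open ≡-Reasoning
    split : ℕtoℚ (suc j * j ! * n-1 !) ≡ ℕtoℚ (suc j) ℚ.* ℕtoℚ (j ! * n-1 !)
    split = trans (cong ℕtoℚ (ℕP.*-assoc (suc j) (j !) (n-1 !))) (ℕtoℚ-homo-* (suc j) (j ! * n-1 !))
    regroup : ∀ b ω s p → b ℚ.* ω ℚ.* (s ℚ.* p) ≡ b ℚ.* p ℚ.* (ω ℚ.* s)
    regroup = solve-∀ ℚ-ring
    rearrange : ∀ a f ω s → a ℚ.* f ℚ.* (ω ℚ.* s) ≡ f ℚ.* (ω ℚ.* (s ℚ.* a))
    rearrange = solve-∀ ℚ-ring
    absorb : ℕtoℚ ((n-1 ∸ j) * (n-1 ∸ suc j) !) ℚ.* (w (suc j) ℚ.* ℕtoℚ (suc j))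
           ≡ ℕtoℚ ((n-1 ∸ suc j) !) ℚ.* (w (suc j) ℚ.* ℕtoℚ (suc j * (n ∸ suc j)))
    absorb = trans (cong (ℚ._* (w (suc j) ℚ.* ℕtoℚ (suc j))) (ℕtoℚ-homo-* (n-1 ∸ j) ((n-1 ∸ suc j) !)))
            (trans (rearrange (ℕtoℚ (n-1 ∸ j)) (ℕtoℚ ((n-1 ∸ suc j) !)) (w (suc j)) (ℕtoℚ (suc j)))
                   (cong (λ t → ℕtoℚ ((n-1 ∸ suc j) !) ℚ.* (w (suc j) ℚ.* t)) (sym (ℕtoℚ-homo-* (suc j) (n-1 ∸ j)))))

  F*F*v≡κ : ∀ i → i < n → F ℚ.* (F ℚ.* v n i) ≡ κ n i
  F*F*v≡κ i (s≤s i≤n-1) = *ℕtoℚ-cancelʳ D {{ℕP._!*_!≢0 (suc i) i}} (begin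
    F ℚ.* (F ℚ.* (β i ℚ.* c)) ℚ.* ℕtoℚ (suc i ! * i !)
      ≡⟨ cong (F ℚ.* (F ℚ.* (β i ℚ.* c)) ℚ.*_) (ℕtoℚ-homo-* (suc i !) (i !)) ⟩
    F ℚ.* (F ℚ.* (β i ℚ.* c)) ℚ.* (ℕtoℚ (suc i !) ℚ.* ℕtoℚ (i !))
      ≡⟨ regroup F (β i) c (ℕtoℚ (suc i !)) (ℕtoℚ (i !)) ⟩
    F ℚ.* (β i ℚ.* (ℕtoℚ (i !) ℚ.* F) ℚ.* (c ℚ.* ℕtoℚ (suc i !)))
      ≡⟨ cong (λ t → F ℚ.* (β i ℚ.* t ℚ.* (c ℚ.* ℕtoℚ (suc i !)))) (ℕtoℚ-homo-* (i !) (n-1 !)) ⟨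
    F ℚ.* (β i ℚ.* ℕtoℚ (i ! * n-1 !) ℚ.* (c ℚ.* ℕtoℚ (suc i !)))
      ≡⟨ cong (λ t → F ℚ.* (t ℚ.* (c ℚ.* ℕtoℚ (suc i !)))) (β*[i!*[n-1]!]≡[n-1-i]! i i≤n-1) ⟩
    F ℚ.* (ℕtoℚ ((n-1 ∸ i) !) ℚ.* (c ℚ.* ℕtoℚ (suc i !)))
      ≡⟨ cong (F ℚ.*_) binomial ⟩
    F ℚ.* ℕtoℚ (n !)
      ≡⟨ trans (ℕtoℚ-homo-* (n !) (n-1 !)) (ℚP.*-comm (ℕtoℚ (n !)) F) ⟨
    ℕtoℚ (n ! * n-1 !)
      ≡⟨ frac*ℕtoℚ≡ℕtoℚ (n ! * n-1 !) D {{ℕP._!*_!≢0 (suc i) i}} ⟨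
    κ n i ℚ.* ℕtoℚ D ∎)
    where
    open ≡-Reasoning
    D = suc i ! * i !
    c = ℕtoℚ (n C suc i)
    regroup : ∀ f b c s i → f ℚ.* (f ℚ.* (b ℚ.* c)) ℚ.* (s ℚ.* i) ≡ f ℚ.* (b ℚ.* (i ℚ.* f) ℚ.* (c ℚ.* s))
    regroup = solve-∀ ℚ-ring
    rotate : ∀ e c s → e ℚ.* (c ℚ.* s) ≡ c ℚ.* (s ℚ.* e)
    rotate = solve-∀ ℚ-ring
    binomial : ℕtoℚ ((n-1 ∸ i) !) ℚ.* (c ℚ.* ℕtoℚ (suc i !)) ≡ ℕtoℚ (n !)
    binomial = begin
      ℕtoℚ ((n-1 ∸ i) !) ℚ.* (c ℚ.* ℕtoℚ (suc i !))        ≡⟨ rotate (ℕtoℚ ((n-1 ∸ i) !)) c (ℕtoℚ (suc i !)) ⟩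
      c ℚ.* (ℕtoℚ (suc i !) ℚ.* ℕtoℚ ((n-1 ∸ i) !))        ≡⟨ cong (c ℚ.*_) (ℕtoℚ-homo-* (suc i !) ((n-1 ∸ i) !)) ⟨
      c ℚ.* ℕtoℚ (suc i ! * (n-1 ∸ i) !)                   ≡⟨ ℕtoℚ-homo-* (n C suc i) (suc i ! * (n-1 ∸ i) !) ⟨
      ℕtoℚ ((n C suc i) * (suc i ! * (n-1 ∸ i) !))         ≡⟨ cong ℕtoℚ (nCk*[k!*[n∸k]!]≡n! (s≤s i≤n-1)) ⟩
      ℕtoℚ (n !)                                           ∎

  F⊙F⊙V≗Q : F ⊙ F ⊙ V n ≗ Q n
  F⊙F⊙V≗Q = begin
    F ⊙ F ⊙ V n                                  ≈⟨ ⊙-congʳ F (⊙-congʳ F V≗comb) ⟩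
    F ⊙ F ⊙ comb n (v n)                         ≈⟨ ⊙-congʳ F (comb-⊙ n F (v n)) ⟩
    F ⊙ comb n (λ i → F ℚ.* v n i)               ≈⟨ comb-⊙ n F (λ i → F ℚ.* v n i) ⟩
    comb n (λ i → F ℚ.* (F ℚ.* v n i))           ≈⟨ comb-cong n F*F*v≡κ ⟩
    comb n (κ n)                                 ≈⟨ ≗.sym (Q≗comb n-1) ⟩
    Q n                                          ∎
    where open ≗-Reasoning

proposition6 : (n : ℕ) → 1 ≤ n → (k : ℕ) → coeff (lhs n) k ≡ coeff (rhs n) k
proposition6 (suc n-1) (s≤s z≤n) = begin
  coeff (lhs n)
    ≈⟨ coeff-lhs ⟩
  F ⊙ F ⊙ (∑[ p ∈ compositions n ] term 0 p)
    ≈⟨ ⊙-congʳ F (⊙-congʳ F (∑compositions≗V n-1 n-1 0 ℕP.≤-refl refl)) ⟩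
  F ⊙ F ⊙ V n
    ≈⟨ F⊙F⊙V≗Q ⟩
  Q n
    ≈⟨ ≗.sym (coeff-rhs n) ⟩
  coeff (rhs n) ∎
  where
  open ≗-Reasoning
  open ClosedForm n-1
  open Compositions n
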